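{- Let $\bar\Gamma$ be the point-hyperplane geometry of $\mathrm{PG}(n,q)$. Then: (1) Every singular hyperplane of $\bar\Gamma$ has cardinality \[\frac{(q^{n+1}-1)(q^{n-1}-1)}{(q-1)^2}+\frac{q^n-1}{q-1}\,q^{n-1}.\] (2) Every quasi-singular but not singular hyperplane of $\bar\Gamma$ has cardinality \[\frac{(q^{n+1}-1)(q^{n-1}-1)}{(q-1)^2}+\Big(\frac{q^n-1}{q-1}+1\Big)q^{n-1}.\]
   Context: The points of $\bar\Gamma$ are the pairs $(p,H)$ with $p$ a point and $H$ a hyperplane of $\mathrm{PG}(n,q)$ with $p\in H$; two points $(p,H),(p',H')$ are collinear iff $p=p'$ or $H=H'$. For a point $p$ and a hyperplane $A$ of $\mathrm{PG}(n,q)$, the quasi-singular hyperplane $\mathcal H_{p,A}$ is the set of points of $\bar\Gamma$ collinear with (or equal to) some point of $\{(p,H):p\in H\}\cup\{(x,A):x\in A\}$, i.e. $\mathcal H_{p,A}=\{(x,H)\in\bar\Gamma: x=p\text{ or }x\in A\text{ or }p\in H\text{ or }H=A\}$. It is called singular if $p\in A$. -}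

module Defs where

open import Level using (0ℓ)
open import Algebra.Bundles using (CommutativeRing)
open import Data.Nat using (ℕ; suc; NonZero)
import Data.Nat as N
open import Data.Nat.DivMod using (_/_)
open import Data.Nat.Properties using (m*n≢0)
open import Data.Fin using (Fin)
open import Data.Vec using (Vec; []; _∷_; foldr; zipWith)
import Data.Vec.Properties as VecP
open import Data.Bool using (Bool; true; false; T; _∨_; if_then_else_)
open import Data.Product using (Σ; _×_; _,_; ∃; proj₁)
open import Relation.Nullary using (¬_; does)
open import Relation.Binary.PropositionalEquality using (_≡_)
open import Relation.Binary.Definitions using (DecidableEquality)
open import Function.Bundles using (_↔_)

record FiniteField (q : ℕ) : Set₁ where
  field
    commRing : CommutativeRing 0ℓ 0ℓ
  open CommutativeRing commRing public hiding (ring)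
  field
    ≈⇒≡     : ∀ {x y} → x ≈ y → x ≡ y
    0≢1     : ¬ (0# ≡ 1#)
    inverse : ∀ x → ¬ (x ≡ 0#) → ∃ λ y → x * y ≡ 1#
    _≟F_    : DecidableEquality Carrier
    enum    : Fin q ↔ Carrier

HasSize : Set → ℕ → Set
HasSize A k = Fin k ↔ A

module PG {q : ℕ} (F : FiniteField q) (n : ℕ) where
  open FiniteField F

  V : Set
  V = Vec Carrier (suc n)

  normalised : ∀ {m} → Vec Carrier m → Bool
  normalised []       = false
  normalised (x ∷ xs) = if does (x ≟F 0#) then normalised xs else does (x ≟F 1#)

  -- Points of PG(n,q): 1-dim subspaces, represented by their unique
  -- normalised spanning vector.
  Point : Set
  Point = Σ V (λ v → T (normalised v))

  -- Hyperplanes of PG(n,q): kernels of nonzero linear forms, represented by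
  -- the unique normalised coefficient vector of the form.
  Hyperplane : Set
  Hyperplane = Σ V (λ v → T (normalised v))

  dot : V → V → Carrier
  dot u v = foldr _ _+_ 0# (zipWith _*_ u v)

  -- incidence p ∈ H (boolean, so that it is proof-irrelevant)
  inc : Point → Hyperplane → Bool
  inc (x , _) (h , _) = does (dot h x ≟F 0#)

  _∈H_ : Point → Hyperplane → Set
  p ∈H H = T (inc p H)

  eqP : Point → Point → Bool
  eqP (x , _) (y , _) = does (VecP.≡-dec _≟F_ x y)

  eqH : Hyperplane → Hyperplane → Bool
  eqH (x , _) (y , _) = does (VecP.≡-dec _≟F_ x y)

  Γpoint : Set
  Γpoint = Σ (Point × Hyperplane) (λ { (p , H) → p ∈H H })

  inQS : Point → Hyperplane → Γpoint → Bool
  inQS p A ((x , H) , _) = eqP x p ∨ inc x A ∨ inc p H ∨ eqH H A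

  QS : Point → Hyperplane → Set
  QS p A = Σ Γpoint (λ y → T (inQS p A y))

-- Numerical formulas (all divisions are exact).
module Formulas (q n : ℕ) .{{q-1≢0 : NonZero (q N.∸ 1)}} where
  open N using (_+_; _*_; _∸_; _^_)
  common : ℕ
  common = _/_ ((q ^ (n + 1) ∸ 1) * (q ^ (n ∸ 1) ∸ 1)) ((q ∸ 1) * (q ∸ 1))
             {{m*n≢0 (q ∸ 1) (q ∸ 1)}}

  singularSize : ℕ
  singularSize = common + ((q ^ n ∸ 1) / (q ∸ 1)) * q ^ (n ∸ 1)

  nonSingularSize : ℕ
  nonSingularSize = common + ((q ^ n ∸ 1) / (q ∸ 1) + 1) * q ^ (n ∸ 1)

{-# OPTIONS --safe #-}

-- Count H_{p,A} fibrewise over the point x of a flag (x, H). If x = p or x ∈ A, every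
-- hyperplane through x gives a flag of H_{p,A}; otherwise H = A is impossible (x ∈ H, x ∉ A),
-- so the fibre is the set of hyperplanes through the two points x and p.
-- Writing [k] = (q^k − 1)/(q − 1), PG(n,q) has [n+1] points, [n] hyperplanes through a point
-- and [n−1] through two points: the solutions of one (resp. two independent) homogeneous
-- linear equations in F^(n+1) number q^n (resp. q^(n−1)), found by solving for one coordinate,
-- and the nonzero ones fall into classes of q − 1 proportional vectors, each containing exactly
-- one normalised representative.
-- If c points satisfy x = p or x ∈ A (c = [n] when p ∈ A, c = [n] + 1 otherwise), then
-- |H_{p,A}| = c [n] + ([n+1] − c) [n−1] = [n+1] [n−1] + c q^(n−1), as [n] = [n−1] + q^(n−1).

module Submission where

open import Defs
open import Data.Nat using (ℕ; _≤_; _∸_; NonZero)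
open import Data.Product using (_×_)
open import Relation.Nullary using (¬_)

open import Algebra.Bundles using (CommutativeRing)
open import Data.Bool using (Bool; true; false; T; not; _∧_; _∨_; if_then_else_)
open import Data.Bool.Properties using (T-irrelevant; T-∧; T-∨; ∧-identityʳ; ∨-assoc; ∨-identityʳ)
open import Data.Empty using (⊥-elim)
open import Data.Fin using (Fin; zero; suc)
open import Data.Nat using (zero; suc; s≤s)
open import Data.Product using (Σ; ∃; _,_; proj₁; proj₂; map₂)
open import Data.Sum using (_⊎_; inj₁; inj₂; [_,_])
open import Data.Unit using (⊤; tt)
open import Data.Vec using (Vec; []; _∷_; foldr; zipWith; map; replicate; lookup; removeAt; insertAt; head; tail)
open import Function using (_∘_; _↔_; _⇔_; mk↔ₛ′; mk⇔; Inverse; Equivalence)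
open import Function.Properties.Inverse using (↔-refl; ↔-sym; ↔-trans)
open import Relation.Binary.PropositionalEquality
  using (_≡_; _≢_; refl; sym; trans; cong; cong₂; subst; module ≡-Reasoning)
open import Relation.Nullary using (Dec; yes; no; does)

module FiniteSets where
  open import Data.Fin.Permutation using (↔⇒≡)
  open import Data.Fin.Properties using (0↔⊥; 1↔⊤; +↔⊎; *↔×)
  open import Data.Nat using (_+_; _*_; _^_)
  open import Data.Product.Algebra using (×-cong)
  open import Data.Product.Function.Dependent.Propositional using (Σ-↔)
  open import Data.Sum.Algebra using (⊎-cong)

  private variable
    A B : Set
    k m n : ℕ

  does-sound : (d : Dec A) → T (does d) → A
  does-sound (yes a) _ = a

  does-complete : (d : Dec A) → A → T (does d)
  does-complete (yes _)  _ = tt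
  does-complete (no ¬a) a = ¬a a

  not-does-sound : (d : Dec A) → T (not (does d)) → ¬ A
  not-does-sound (no ¬a) _ = ¬a

  not-does-complete : (d : Dec A) → ¬ A → T (not (does d))
  not-does-complete (yes a) ¬a = ¬a a
  not-does-complete (no _)  _  = tt

  ∧-cong-T : ∀ a {b c} → (T a → b ≡ c) → a ∧ b ≡ a ∧ c
  ∧-cong-T true  b≡c = b≡c tt
  ∧-cong-T false _   = refl

  T-not-∨ˡ : ∀ a {b} → T (not (a ∨ b)) → T (not a)
  T-not-∨ˡ false _ = tt

  T-∧-absorbʳ : ∀ {a b} → T b → T (a ∧ b) ⇔ T a
  T-∧-absorbʳ Tb = mk⇔ (proj₁ ∘ Equivalence.to T-∧) (λ Ta → Equivalence.from T-∧ (Ta , Tb))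

  Subset : (A : Set) → (A → Bool) → Set
  Subset A P = Σ A (T ∘ P)

  Subset-≡ : {P : A → Bool} {x y : A} {s : T (P x)} {t : T (P y)} →
             x ≡ y → _≡_ {A = Subset A P} (x , s) (y , t)
  Subset-≡ refl = cong (_ ,_) (T-irrelevant _ _)

  Subset-cong : {P Q : A → Bool} → (∀ x → T (P x) ⇔ T (Q x)) → Subset A P ↔ Subset A Q
  Subset-cong P⇔Q = mk↔ₛ′ (map₂ (Equivalence.to (P⇔Q _))) (map₂ (Equivalence.from (P⇔Q _)))
    (λ _ → Subset-≡ refl) (λ _ → Subset-≡ refl)

  Subset-cong-≡ : {P Q : A → Bool} → (∀ x → P x ≡ Q x) → Subset A P ↔ Subset A Q
  Subset-cong-≡ P≡Q = Subset-cong (λ x → mk⇔ (subst T (P≡Q x)) (subst T (sym (P≡Q x))))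

  Subset-all : Subset A (λ _ → true) ↔ A
  Subset-all = mk↔ₛ′ proj₁ (_, tt) (λ _ → refl) (λ _ → refl)

  split-on : ∀ {R : Set} b → (T b → R) → (T (not b) → R) → R
  split-on true  f _ = f tt
  split-on false _ g = g tt

  module _ {R : Set} where

    split-on-true : ∀ {b} (t : T b) {f : T b → R} {g} → split-on b f g ≡ f t
    split-on-true {true} tt = refl

    split-on-false : ∀ {b} (t : T (not b)) {f} {g : T (not b) → R} → split-on b f g ≡ g t
    split-on-false {false} tt = refl

    split-on-ind : (C : R → Set) (b : Bool) {f : T b → R} {g : T (not b) → R} →
                   (∀ t → C (f t)) → (∀ t → C (g t)) → C (split-on b f g)
    split-on-ind C true  Cf _  = Cf tt
    split-on-ind C false _  Cg = Cg tt

  Σ-split : {B : A → Set} (P : A → Bool) →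
            Σ A B ↔ (Σ (Subset A P) (B ∘ proj₁) ⊎ Σ (Subset A (not ∘ P)) (B ∘ proj₁))
  Σ-split {A = A} {B = B} P = mk↔ₛ′ to from to∘from from∘to
    where
    to : Σ A B → Σ (Subset A P) (B ∘ proj₁) ⊎ Σ (Subset A (not ∘ P)) (B ∘ proj₁)
    to (x , b) = split-on (P x) (λ t → inj₁ ((x , t) , b)) (λ t → inj₂ ((x , t) , b))

    from : Σ (Subset A P) (B ∘ proj₁) ⊎ Σ (Subset A (not ∘ P)) (B ∘ proj₁) → Σ A B
    from = [ (λ ((x , _) , b) → x , b) , (λ ((x , _) , b) → x , b) ]

    to∘from : ∀ y → to (from y) ≡ y
    to∘from (inj₁ ((_ , t) , _)) = split-on-true t
    to∘from (inj₂ ((_ , t) , _)) = split-on-false t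

    from∘to : ∀ y → from (to y) ≡ y
    from∘to (x , b) = split-on-ind (λ y → from y ≡ (x , b)) (P x) (λ _ → refl) (λ _ → refl)

  Subset-∨ : {P Q : A → Bool} → (∀ x → T (Q x) → T (not (P x))) →
             Subset A (λ x → P x ∨ Q x) ↔ (Subset A P ⊎ Subset A Q)
  Subset-∨ {A = A} {P = P} {Q = Q} Q⇒¬P = mk↔ₛ′ to from to∘from from∘to
    where
    resolve : ∀ {a b} → T (not a) → T (a ∨ b) → T b
    resolve {false} _ t = t

    to : Subset A (λ x → P x ∨ Q x) → Subset A P ⊎ Subset A Q
    to (x , t) = split-on (P x) (λ p → inj₁ (x , p)) (λ p̄ → inj₂ (x , resolve p̄ t))

    from : Subset A P ⊎ Subset A Q → Subset A (λ x → P x ∨ Q x)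
    from = [ map₂ (λ p → Equivalence.from T-∨ (inj₁ p)) , map₂ (λ q → Equivalence.from T-∨ (inj₂ q)) ]

    to∘from : ∀ y → to (from y) ≡ y
    to∘from (inj₁ (_ , p)) = split-on-true p
    to∘from (inj₂ (x , q)) = trans (split-on-false (Q⇒¬P x q)) (cong inj₂ (Subset-≡ refl))

    from∘to : ∀ y → from (to y) ≡ y
    from∘to (x , t) = split-on-ind (λ y → from y ≡ (x , t)) (P x) (λ _ → Subset-≡ refl) (λ _ → Subset-≡ refl)

  HasSize-↔ : HasSize A k → A ↔ B → HasSize B k
  HasSize-↔ = ↔-trans

  HasSize-unique : HasSize A m → HasSize A n → m ≡ n
  HasSize-unique e e′ = ↔⇒≡ (↔-trans e (↔-sym e′))

  HasSize-⊎ : HasSize A m → HasSize B n → HasSize (A ⊎ B) (m + n)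
  HasSize-⊎ e e′ = ↔-trans +↔⊎ (⊎-cong e e′)

  HasSize-× : HasSize A m → HasSize B n → HasSize (A × B) (m * n)
  HasSize-× e e′ = ↔-trans *↔× (×-cong e e′)

  HasSize-Σ-const : {B : A → Set} → HasSize A m → (∀ x → HasSize (B x) n) → HasSize (Σ A B) (m * n)
  HasSize-Σ-const e eB = HasSize-↔ (HasSize-× e ↔-refl) (Σ-↔ ↔-refl (eB _))

  HasSize-Vec : HasSize A k → ∀ m → HasSize (Vec A m) (k ^ m)
  HasSize-Vec e zero    = mk↔ₛ′ (λ _ → []) (λ _ → zero) (λ { [] → refl }) (λ { zero → refl })
  HasSize-Vec e (suc m) = HasSize-↔ (HasSize-× e (HasSize-Vec e m)) ×↔Vec-suc
    where
    ×↔Vec-suc : (A × Vec A m) ↔ Vec A (suc m)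
    ×↔Vec-suc = mk↔ₛ′ (λ (x , xs) → x ∷ xs) (λ { (x ∷ xs) → x , xs })
      (λ { (_ ∷ _) → refl }) (λ { (_ , _) → refl })

  HasSize-singleton : {P : A → Bool} (a : A) → T (P a) → (∀ x → T (P x) → x ≡ a) → HasSize (Subset A P) 1
  HasSize-singleton a Pa unique = HasSize-↔ 1↔⊤
    (mk↔ₛ′ (λ _ → a , Pa) (λ _ → tt) (λ (x , Px) → Subset-≡ (sym (unique x Px))) (λ _ → refl))

  HasSize-Σ-split : {B : A → Set} (P : A → Bool) →
                    HasSize (Σ (Subset A P) (B ∘ proj₁)) m → HasSize (Σ (Subset A (not ∘ P)) (B ∘ proj₁)) n →
                    HasSize (Σ A B) (m + n)
  HasSize-Σ-split P e e′ = HasSize-↔ (HasSize-⊎ e e′) (↔-sym (Σ-split P))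

  HasSize-partition : (P : A → Bool) → HasSize (Subset A P) m → HasSize (Subset A (not ∘ P)) n →
                      HasSize A (m + n)
  HasSize-partition P e e′ = HasSize-↔
    (HasSize-Σ-split {B = λ _ → ⊤} P (HasSize-↔ e (↔-sym Subset-all)) (HasSize-↔ e′ (↔-sym Subset-all)))
    Subset-all

  HasSize-T : ∀ b → ∃ (HasSize (T b))
  HasSize-T true  = 1 , 1↔⊤
  HasSize-T false = 0 , 0↔⊥

  Σ-Fin-suc : {B : Fin (suc k) → Set} → Σ (Fin (suc k)) B ↔ (B zero ⊎ Σ (Fin k) (B ∘ suc))
  Σ-Fin-suc = mk↔ₛ′
    (λ { (zero , b) → inj₁ b ; (suc i , b) → inj₂ (i , b) })
    [ (λ b → zero , b) , (λ (i , b) → suc i , b) ]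
    (λ { (inj₁ _) → refl ; (inj₂ _) → refl })
    (λ { (zero , _) → refl ; (suc _ , _) → refl })

  Fin-subset-size : (P : Fin k → Bool) → ∃ (HasSize (Subset (Fin k) P))
  Fin-subset-size {zero}  P = 0 , mk↔ₛ′ (λ ()) (λ ()) (λ ()) (λ ())
  Fin-subset-size {suc k} P =
    let a , e = HasSize-T (P zero); b , e′ = Fin-subset-size (P ∘ suc)
    in a + b , HasSize-↔ (HasSize-⊎ e e′) (↔-sym Σ-Fin-suc)

  HasSize-subset : HasSize A k → (P : A → Bool) → ∃ (HasSize (Subset A P))
  HasSize-subset e P = map₂ (λ e′ → HasSize-↔ e′ (Σ-↔ e ↔-refl)) (Fin-subset-size (P ∘ Inverse.to e))

open FiniteSets

-- The field size is written suc r, so that the q ∸ 1 of Formulas is definitionally r.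
module QNumbers (r : ℕ) ⦃ _ : NonZero r ⦄ where
  open import Data.Nat using (_+_; _*_; _^_)
  open import Data.Nat.DivMod using (_/_; m*n/n≡m; /-*-interchange)
  open import Data.Nat.Divisibility using (_∣_; divides)
  open import Data.Nat.Properties using (*-comm; *-zeroʳ; *-distribˡ-+; +-comm; m*n≢0)
  open import Data.Nat.Tactic.RingSolver using (solve-∀)
  open ≡-Reasoning

  [_]q : ℕ → ℕ
  [ k ]q = (suc r ^ k ∸ 1) / r

  geometric : ℕ → ℕ
  geometric zero    = 0
  geometric (suc k) = suc r ^ k + geometric k

  ^≡1+r*geometric : ∀ k → suc r ^ k ≡ suc (r * geometric k)
  ^≡1+r*geometric zero    = cong suc (sym (*-zeroʳ r))
  ^≡1+r*geometric (suc k) = begin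
    suc r ^ k + r * suc r ^ k              ≡⟨ cong (_+ r * suc r ^ k) (^≡1+r*geometric k) ⟩
    suc (r * geometric k + r * suc r ^ k)  ≡⟨ cong suc (+-comm (r * geometric k) _) ⟩
    suc (r * suc r ^ k + r * geometric k)  ≡⟨ cong suc (*-distribˡ-+ r _ _) ⟨
    suc (r * geometric (suc k))            ∎

  r∣^∸1 : ∀ k → r ∣ suc r ^ k ∸ 1
  r∣^∸1 k = divides (geometric k) (begin
    suc r ^ k ∸ 1              ≡⟨ cong (_∸ 1) (^≡1+r*geometric k) ⟩
    r * geometric k            ≡⟨ *-comm r _ ⟩
    geometric k * r            ∎)

  [k]≡geometric : ∀ k → [ k ]q ≡ geometric k
  [k]≡geometric k = begin
    (suc r ^ k ∸ 1) / r    ≡⟨ cong (_/ r) (_∣_.equality (r∣^∸1 k)) ⟩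
    geometric k * r / r    ≡⟨ m*n/n≡m (geometric k) r ⟩
    geometric k            ∎

  ^≡1+r*[k] : ∀ k → suc r ^ k ≡ suc (r * [ k ]q)
  ^≡1+r*[k] k = begin
    suc r ^ k                ≡⟨ ^≡1+r*geometric k ⟩
    suc (r * geometric k)    ≡⟨ cong (λ g → suc (r * g)) ([k]≡geometric k) ⟨
    suc (r * [ k ]q)          ∎

  [1+k]≡^+[k] : ∀ k → [ suc k ]q ≡ suc r ^ k + [ k ]q
  [1+k]≡^+[k] k = begin
    [ suc k ]q                  ≡⟨ [k]≡geometric (suc k) ⟩
    suc r ^ k + geometric k    ≡⟨ cong (suc r ^ k +_) ([k]≡geometric k) ⟨
    suc r ^ k + [ k ]q          ∎

  private instance
    r*r≢0 : NonZero (r * r)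
    r*r≢0 = m*n≢0 r r

  product-/-r² : ∀ a b → (suc r ^ a ∸ 1) * (suc r ^ b ∸ 1) / (r * r) ≡ [ a ]q * [ b ]q
  product-/-r² a b = /-*-interchange (r∣^∸1 a) (r∣^∸1 b)

  flag-count : ∀ m c₁ c₂ → c₁ + c₂ ≡ [ suc (suc m) ]q →
               c₁ * [ suc m ]q + c₂ * [ m ]q ≡ Formulas.common (suc r) (suc m) + c₁ * suc r ^ m
  flag-count m c₁ c₂ c₁+c₂≡N = begin
    c₁ * [ suc m ]q + c₂ * [ m ]q                   ≡⟨ cong (λ M → c₁ * M + c₂ * [ m ]q) ([1+k]≡^+[k] m) ⟩
    c₁ * (suc r ^ m + [ m ]q) + c₂ * [ m ]q         ≡⟨ regroup c₁ c₂ (suc r ^ m) [ m ]q ⟩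
    (c₁ + c₂) * [ m ]q + c₁ * suc r ^ m            ≡⟨ cong (λ N → N * [ m ]q + c₁ * suc r ^ m) c₁+c₂≡N ⟩
    [ suc (suc m) ]q * [ m ]q + c₁ * suc r ^ m      ≡⟨ cong (λ k → [ k ]q * [ m ]q + c₁ * suc r ^ m) (+-comm 1 (suc m)) ⟩
    [ suc m + 1 ]q * [ m ]q + c₁ * suc r ^ m        ≡⟨ cong (_+ c₁ * suc r ^ m) (product-/-r² (suc m + 1) m) ⟨
    Formulas.common (suc r) (suc m) + c₁ * suc r ^ m ∎
    where
    regroup : ∀ a b c d → a * (c + d) + b * d ≡ (a + b) * d + a * c
    regroup = solve-∀

insertAt-replicate : ∀ {A : Set} {m} (i : Fin (suc m)) (a : A) → insertAt (replicate m a) i a ≡ replicate (suc m) a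
insertAt-replicate zero          a = refl
insertAt-replicate {m = suc m} (suc i) a = cong (a ∷_) (insertAt-replicate i a)

module LinearAlgebra {q : ℕ} (F : FiniteField q) where
  open import Data.Nat using (_^_)
  open import Data.Vec.Properties
    using (map-∘; map-cong; map-id; lookup-map; lookup-zipWith; insertAt-lookup; removeAt-insertAt; insertAt-removeAt)
  open import Relation.Nullary.Decidable using (does-⇔)
  open FiniteField F
    using ( Carrier; _+_; _*_; -_; 0#; 1#; ≈⇒≡; 0≢1; inverse; _≟F_; enum; commRing
          ; _≈_; +-congˡ; *-comm; *-assoc; *-identityˡ; *-identityʳ; zeroˡ; zeroʳ
          ; +-identityˡ; +-identityʳ; -‿inverseˡ; -‿inverseʳ )
    renaming (refl to ≈-refl; reflexive to ≈-reflexive; trans to ≈-trans)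
  open import Algebra.Properties.Group (CommutativeRing.+-group commRing) using (inverseˡ-unique; x∙y⁻¹≈ε⇒x≈y)
  open import Algebra.Solver.Ring.NaturalCoefficients.Default (CommutativeRing.commutativeSemiring commRing)
    using (solve; _:+_; _:*_; _:=_)
  open import Algebra.Properties.Ring (CommutativeRing.ring commRing) using (-‿distribˡ-*)
  open ≡-Reasoning

  private variable
    m : ℕ

  isZero : Carrier → Bool
  isZero x = does (x ≟F 0#)

  Nonzero : Set
  Nonzero = Subset Carrier (not ∘ isZero)

  *-cancel-inverse : ∀ {a u} → a * u ≡ 1# → ∀ b → b * a * u ≡ b
  *-cancel-inverse {a} {u} au≡1 b = begin
    b * a * u     ≡⟨ ≈⇒≡ (*-assoc b a u) ⟩
    b * (a * u)   ≡⟨ cong (b *_) au≡1 ⟩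
    b * 1#        ≡⟨ ≈⇒≡ (*-identityʳ b) ⟩
    b             ∎

  x*y≡0⇒x≡0 : ∀ {x y} → y ≢ 0# → x * y ≡ 0# → x ≡ 0#
  x*y≡0⇒x≡0 {x} {y} y≢0 xy≡0 = begin
    x              ≡⟨ *-cancel-inverse yy⁻¹≡1 x ⟨
    x * y * y⁻¹    ≡⟨ cong (_* y⁻¹) xy≡0 ⟩
    0# * y⁻¹       ≡⟨ ≈⇒≡ (zeroˡ y⁻¹) ⟩
    0#             ∎
    where
    y⁻¹ = proj₁ (inverse y y≢0)
    yy⁻¹≡1 = proj₂ (inverse y y≢0)

  isZero-* : ∀ {c} → c ≢ 0# → ∀ d → isZero (c * d) ≡ isZero d
  isZero-* {c} c≢0 d = does-⇔ (mk⇔ cd≡0⇒d≡0 d≡0⇒cd≡0) ((c * d) ≟F 0#) (d ≟F 0#)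
    where
    d≡0⇒cd≡0 : d ≡ 0# → c * d ≡ 0#
    d≡0⇒cd≡0 d≡0 = trans (cong (c *_) d≡0) (≈⇒≡ (zeroʳ c))

    cd≡0⇒d≡0 : c * d ≡ 0# → d ≡ 0#
    cd≡0⇒d≡0 cd≡0 = x*y≡0⇒x≡0 c≢0 (trans (≈⇒≡ (*-comm d c)) cd≡0)

  inverse-nonzero : ∀ {a u} → a * u ≡ 1# → u ≢ 0#
  inverse-nonzero {a} {u} au≡1 u≡0 = 0≢1 (begin
    0#       ≡⟨ ≈⇒≡ (zeroʳ a) ⟨
    a * 0#   ≡⟨ cong (a *_) u≡0 ⟨
    a * u    ≡⟨ au≡1 ⟩
    1#       ∎)

  dot : Vec Carrier m → Vec Carrier m → Carrier
  dot u v = foldr _ _+_ 0# (zipWith _*_ u v)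

  infixr 7 _·_
  _·_ : Carrier → Vec Carrier m → Vec Carrier m
  c · v = map (c *_) v

  infixl 6 _+ᵛ_
  _+ᵛ_ : Vec Carrier m → Vec Carrier m → Vec Carrier m
  _+ᵛ_ = zipWith _+_

  0ᵛ : Vec Carrier m
  0ᵛ = replicate _ 0#

  dot-comm : (u v : Vec Carrier m) → dot u v ≡ dot v u
  dot-comm []      []      = refl
  dot-comm (a ∷ u) (b ∷ v) = cong₂ _+_ (≈⇒≡ (*-comm a b)) (dot-comm u v)

  dot-·ˡ : ∀ c (u v : Vec Carrier m) → dot (c · u) v ≡ c * dot u v
  dot-·ˡ c []      []      = sym (≈⇒≡ (zeroʳ c))
  dot-·ˡ c (a ∷ u) (b ∷ v) = begin
    c * a * b + dot (c · u) v  ≡⟨ cong (c * a * b +_) (dot-·ˡ c u v) ⟩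
    c * a * b + c * dot u v    ≡⟨ ≈⇒≡ (solve 4 (λ c a b d → c :* a :* b :+ c :* d := c :* (a :* b :+ d))
                                                 ≈-refl c a b (dot u v)) ⟩
    c * (a * b + dot u v)      ∎

  dot-·ʳ : ∀ c (u v : Vec Carrier m) → dot u (c · v) ≡ c * dot u v
  dot-·ʳ c u v = trans (dot-comm u (c · v)) (trans (dot-·ˡ c v u) (cong (c *_) (dot-comm v u)))

  dot-+ᵛʳ : (u v w : Vec Carrier m) → dot u (v +ᵛ w) ≡ dot u v + dot u w
  dot-+ᵛʳ []      []      []      = sym (≈⇒≡ (+-identityʳ 0#))
  dot-+ᵛʳ (a ∷ u) (b ∷ v) (c ∷ w) = begin
    a * (b + c) + dot u (v +ᵛ w)           ≡⟨ cong (a * (b + c) +_) (dot-+ᵛʳ u v w) ⟩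
    a * (b + c) + (dot u v + dot u w)
      ≡⟨ ≈⇒≡ (solve 5 (λ a b c d e → a :* (b :+ c) :+ (d :+ e) := a :* b :+ d :+ (a :* c :+ e))
                     ≈-refl a b c (dot u v) (dot u w)) ⟩
    a * b + dot u v + (a * c + dot u w)    ∎

  dot-0ᵛˡ : (v : Vec Carrier m) → dot 0ᵛ v ≡ 0#
  dot-0ᵛˡ []      = refl
  dot-0ᵛˡ (b ∷ v) = trans (cong₂ _+_ (≈⇒≡ (zeroˡ b)) (dot-0ᵛˡ v)) (≈⇒≡ (+-identityʳ 0#))

  isZero-dot-0ᵛ : (v : Vec Carrier m) → T (isZero (dot 0ᵛ v))
  isZero-dot-0ᵛ v = does-complete (_ ≟F 0#) (dot-0ᵛˡ v)

  dot-removeAt : (u v : Vec Carrier (suc m)) (i : Fin (suc m)) →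
                 dot u v ≡ lookup u i * lookup v i + dot (removeAt u i) (removeAt v i)
  dot-removeAt (a ∷ u) (b ∷ v) zero = refl
  dot-removeAt (a ∷ u@(_ ∷ _)) (b ∷ v@(_ ∷ _)) (suc i) = begin
    a * b + dot u v
      ≡⟨ cong (a * b +_) (dot-removeAt u v i) ⟩
    a * b + (lookup u i * lookup v i + dot (removeAt u i) (removeAt v i))
      ≡⟨ ≈⇒≡ (solve 3 (λ x y z → x :+ (y :+ z) := y :+ (x :+ z)) ≈-refl _ _ _) ⟩
    lookup u i * lookup v i + (a * b + dot (removeAt u i) (removeAt v i)) ∎

  +ᵛ-·≡0ᵛ⇒≡ : ∀ c (u w : Vec Carrier m) → u +ᵛ (- c) · w ≡ 0ᵛ → u ≡ c · w
  +ᵛ-·≡0ᵛ⇒≡ c []      []      _ = refl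
  +ᵛ-·≡0ᵛ⇒≡ c (a ∷ u) (b ∷ w) e =
    cong₂ _∷_ (≈⇒≡ (x∙y⁻¹≈ε⇒x≈y a (c * b) a-cb≈0)) (+ᵛ-·≡0ᵛ⇒≡ c u w (cong tail e))
    where
    a-cb≈0 : a + - (c * b) ≈ 0#
    a-cb≈0 = ≈-trans (+-congˡ (-‿distribˡ-* c b)) (≈-reflexive (cong head e))

  ·-· : ∀ a b (v : Vec Carrier m) → a · b · v ≡ (a * b) · v
  ·-· a b v = trans (sym (map-∘ (a *_) (b *_) v)) (map-cong (λ x → sym (≈⇒≡ (*-assoc a b x))) v)

  1·v≡v : (v : Vec Carrier m) → 1# · v ≡ v
  1·v≡v v = trans (map-cong (λ x → ≈⇒≡ (*-identityˡ x)) v) (map-id v)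

  ·-inverse : ∀ {a u} → a * u ≡ 1# → (v : Vec Carrier m) → a · u · v ≡ v
  ·-inverse au≡1 v = trans (·-· _ _ v) (trans (cong (_· v) au≡1) (1·v≡v v))

  nonzero-entry : (v : Vec Carrier m) → v ≢ 0ᵛ → ∃ λ i → lookup v i ≢ 0#
  nonzero-entry []      v≢0 = ⊥-elim (v≢0 refl)
  nonzero-entry (a ∷ v) v≢0 with a ≟F 0#
  ... | no  a≢0 = zero , a≢0
  ... | yes refl with nonzero-entry v (v≢0 ∘ cong (0# ∷_))
  ...   | i , vᵢ≢0 = suc i , vᵢ≢0

  lead : Vec Carrier m → Carrier
  lead []      = 0#
  lead (a ∷ v) = if isZero a then lead v else a

  lead-· : ∀ c (v : Vec Carrier m) → lead (c · v) ≡ c * lead v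
  lead-· c []      = sym (≈⇒≡ (zeroʳ c))
  lead-· c (a ∷ v) with (c * a) ≟F 0# | a ≟F 0#
  ... | yes _    | yes _   = lead-· c v
  ... | no  _    | no  _   = refl
  ... | no  ca≢0 | yes a≡0 = ⊥-elim (ca≢0 (trans (cong (c *_) a≡0) (≈⇒≡ (zeroʳ c))))
  ... | yes ca≡0 | no  a≢0 = begin
    lead (c · v)   ≡⟨ lead-· c v ⟩
    c * lead v     ≡⟨ cong (_* lead v) (x*y≡0⇒x≡0 a≢0 ca≡0) ⟩
    0# * lead v    ≡⟨ ≈⇒≡ (zeroˡ (lead v)) ⟩
    0#             ≡⟨ ca≡0 ⟨
    c * a          ∎

  lead-0ᵛ : lead (0ᵛ {m}) ≡ 0#
  lead-0ᵛ {zero}  = refl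
  lead-0ᵛ {suc m} with 0# ≟F 0#
  ... | yes _   = lead-0ᵛ {m}
  ... | no 0≢0 = ⊥-elim (0≢0 refl)

  lead≡0⇒0ᵛ : (v : Vec Carrier m) → lead v ≡ 0# → v ≡ 0ᵛ
  lead≡0⇒0ᵛ []      _ = refl
  lead≡0⇒0ᵛ (a ∷ v) e with a ≟F 0#
  ... | yes a≡0 = cong₂ _∷_ a≡0 (lead≡0⇒0ᵛ v e)
  ... | no  a≢0 = ⊥-elim (a≢0 e)

  Vec-size : ∀ m → HasSize (Vec Carrier m) (q ^ m)
  Vec-size = HasSize-Vec enum

  Nonzero-size : HasSize Nonzero (q ∸ 1)
  Nonzero-size = subst (HasSize Nonzero) (cong (_∸ 1) (HasSize-unique (HasSize-partition isZero zero-size e) enum)) e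
    where
    zero-size : HasSize (Subset Carrier isZero) 1
    zero-size = HasSize-singleton 0# (does-complete (0# ≟F 0#) refl) (λ x → does-sound (x ≟F 0#))
    e = proj₂ (HasSize-subset enum (not ∘ isZero))

  module Kernel {m : ℕ} (x : Vec Carrier (suc m)) (i : Fin (suc m)) (xᵢ≢0 : lookup x i ≢ 0#) where
    xᵢ⁻¹ : Carrier
    xᵢ⁻¹ = proj₁ (inverse (lookup x i) xᵢ≢0)

    xᵢxᵢ⁻¹≡1 : lookup x i * xᵢ⁻¹ ≡ 1#
    xᵢxᵢ⁻¹≡1 = proj₂ (inverse (lookup x i) xᵢ≢0)

    xᵢ⁻¹xᵢ≡1 : xᵢ⁻¹ * lookup x i ≡ 1#
    xᵢ⁻¹xᵢ≡1 = trans (≈⇒≡ (*-comm _ _)) xᵢxᵢ⁻¹≡1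

    solveᵢ : Vec Carrier m → Carrier
    solveᵢ h′ = - dot h′ (removeAt x i) * xᵢ⁻¹

    dot-insertAt : ∀ h′ c → dot (insertAt h′ i c) x ≡ c * lookup x i + dot h′ (removeAt x i)
    dot-insertAt h′ c = trans (dot-removeAt (insertAt h′ i c) x i)
      (cong₂ (λ s t → s * lookup x i + dot t (removeAt x i)) (insertAt-lookup h′ i c) (removeAt-insertAt h′ i c))

    solveᵢ-solves : ∀ h′ → dot (insertAt h′ i (solveᵢ h′)) x ≡ 0#
    solveᵢ-solves h′ = begin
      dot (insertAt h′ i (solveᵢ h′)) x   ≡⟨ dot-insertAt h′ (solveᵢ h′) ⟩
      - d * xᵢ⁻¹ * lookup x i + d         ≡⟨ cong (_+ d) (*-cancel-inverse xᵢ⁻¹xᵢ≡1 (- d)) ⟩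
      - d + d                             ≡⟨ ≈⇒≡ (-‿inverseˡ d) ⟩
      0#                                  ∎
      where d = dot h′ (removeAt x i)

    solveᵢ-unique : ∀ h → dot h x ≡ 0# → solveᵢ (removeAt h i) ≡ lookup h i
    solveᵢ-unique h h·x≡0 = begin
      - d * xᵢ⁻¹                       ≡⟨ cong (_* xᵢ⁻¹) hᵢxᵢ≡-d ⟨
      lookup h i * lookup x i * xᵢ⁻¹   ≡⟨ *-cancel-inverse xᵢxᵢ⁻¹≡1 (lookup h i) ⟩
      lookup h i                       ∎
      where
      d = dot (removeAt h i) (removeAt x i)
      hᵢxᵢ≡-d : lookup h i * lookup x i ≡ - d
      hᵢxᵢ≡-d = ≈⇒≡ (inverseˡ-unique _ d (≈-reflexive (trans (sym (dot-removeAt h x i)) h·x≡0)))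

    kernel↔ : (Q : Vec Carrier m → Bool) →
              Subset (Vec Carrier (suc m)) (λ h → isZero (dot h x) ∧ Q (removeAt h i)) ↔ Subset (Vec Carrier m) Q
    kernel↔ Q = mk↔ₛ′ to from to∘from from∘to
      where
      to : Subset (Vec Carrier (suc m)) (λ h → isZero (dot h x) ∧ Q (removeAt h i)) → Subset (Vec Carrier m) Q
      to (h , t) = removeAt h i , proj₂ (Equivalence.to T-∧ t)

      from : Subset (Vec Carrier m) Q → Subset (Vec Carrier (suc m)) (λ h → isZero (dot h x) ∧ Q (removeAt h i))
      from (h′ , Qh′) = insertAt h′ i (solveᵢ h′) , Equivalence.from T-∧
        (does-complete (_ ≟F 0#) (solveᵢ-solves h′) , subst (T ∘ Q) (sym (removeAt-insertAt h′ i _)) Qh′)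

      to∘from : ∀ y → to (from y) ≡ y
      to∘from (h′ , _) = Subset-≡ (removeAt-insertAt h′ i _)

      from∘to : ∀ y → from (to y) ≡ y
      from∘to (h , t) = Subset-≡ (begin
        insertAt (removeAt h i) i (solveᵢ (removeAt h i))  ≡⟨ cong (insertAt _ i) (solveᵢ-unique h h·x≡0) ⟩
        insertAt (removeAt h i) i (lookup h i)             ≡⟨ insertAt-removeAt h i ⟩
        h                                                  ∎)
        where h·x≡0 = does-sound (_ ≟F 0#) (proj₁ (Equivalence.to T-∧ t))

  kernel-size : (x : Vec Carrier (suc m)) → x ≢ 0ᵛ →
                HasSize (Subset (Vec Carrier (suc m)) (λ h → isZero (dot h x))) (q ^ m)
  kernel-size {m} x x≢0 = HasSize-↔ (Vec-size m)
    (↔-trans (↔-sym Subset-all)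
             (↔-trans (↔-sym (kernel↔ (λ _ → true))) (Subset-cong-≡ (λ _ → ∧-identityʳ _))))
    where open Kernel x (proj₁ (nonzero-entry x x≢0)) (proj₂ (nonzero-entry x x≢0))

  -- With c = pᵢ / xᵢ, the vector y = p − c x has yᵢ = 0 and agrees with p on the kernel of x,
  -- so there the condition h · p = 0 only involves the coordinates of h other than hᵢ.
  kernel₂-size : (x p : Vec Carrier (suc (suc m))) → x ≢ 0ᵛ → (∀ c → p ≢ c · x) →
                 HasSize (Subset (Vec Carrier (suc (suc m))) (λ h → isZero (dot h x) ∧ isZero (dot h p))) (q ^ m)
  kernel₂-size x p x≢0 p∉Fx = HasSize-↔ (kernel-size y′ y′≢0)
    (↔-trans (↔-sym (kernel↔ (λ h′ → isZero (dot h′ y′))))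
             (Subset-cong-≡ (λ h → ∧-cong-T (isZero (dot h x))
                                 (cong isZero ∘ sym ∘ h·p≡h′·y′ h ∘ does-sound (_ ≟F 0#)))))
    where
    i = proj₁ (nonzero-entry x x≢0)
    open Kernel x i (proj₂ (nonzero-entry x x≢0))

    c = lookup p i * xᵢ⁻¹
    y = p +ᵛ (- c) · x
    y′ = removeAt y i

    yᵢ≡0 : lookup y i ≡ 0#
    yᵢ≡0 = begin
      lookup y i                          ≡⟨ lookup-zipWith _+_ i p _ ⟩
      lookup p i + lookup ((- c) · x) i   ≡⟨ cong (lookup p i +_) (lookup-map i _ x) ⟩
      lookup p i + - c * lookup x i       ≡⟨ cong (lookup p i +_) (≈⇒≡ (-‿distribˡ-* c _)) ⟨
      lookup p i + - (c * lookup x i)     ≡⟨ cong (λ z → lookup p i + - z) (*-cancel-inverse xᵢ⁻¹xᵢ≡1 _) ⟩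
      lookup p i + - lookup p i           ≡⟨ ≈⇒≡ (-‿inverseʳ _) ⟩
      0#                                  ∎

    h·p≡h′·y′ : ∀ h → dot h x ≡ 0# → dot h p ≡ dot (removeAt h i) y′
    h·p≡h′·y′ h h·x≡0 = begin
      dot h p                                          ≡⟨ ≈⇒≡ (+-identityʳ _) ⟨
      dot h p + 0#                                     ≡⟨ cong (dot h p +_) -c*0≡0 ⟨
      dot h p + - c * dot h x                          ≡⟨ cong (dot h p +_) (dot-·ʳ (- c) h x) ⟨
      dot h p + dot h ((- c) · x)                      ≡⟨ dot-+ᵛʳ h p _ ⟨
      dot h y                                          ≡⟨ dot-removeAt h y i ⟩
      lookup h i * lookup y i + dot (removeAt h i) y′  ≡⟨ cong (λ z → lookup h i * z + dot (removeAt h i) y′) yᵢ≡0 ⟩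
      lookup h i * 0# + dot (removeAt h i) y′          ≡⟨ cong (_+ dot (removeAt h i) y′) (≈⇒≡ (zeroʳ _)) ⟩
      0# + dot (removeAt h i) y′                       ≡⟨ ≈⇒≡ (+-identityˡ _) ⟩
      dot (removeAt h i) y′                            ∎
      where
      -c*0≡0 : - c * dot h x ≡ 0#
      -c*0≡0 = trans (cong (- c *_) h·x≡0) (≈⇒≡ (zeroʳ _))

    y′≢0 : y′ ≢ 0ᵛ
    y′≢0 y′≡0 = p∉Fx c (+ᵛ-·≡0ᵛ⇒≡ c p x (begin
      y                              ≡⟨ insertAt-removeAt y i ⟨
      insertAt y′ i (lookup y i)     ≡⟨ cong₂ (λ u a → insertAt u i a) y′≡0 yᵢ≡0 ⟩
      insertAt 0ᵛ i 0#               ≡⟨ insertAt-replicate i 0# ⟩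
      0ᵛ                             ∎))

  module Projective (n : ℕ) where
    open PG F n using (Point; normalised)

    private
      V : Set
      V = Vec Carrier (suc n)

    normalised≡lead≟1 : (v : Vec Carrier m) → normalised v ≡ does (lead v ≟F 1#)
    normalised≡lead≟1 [] with 0# ≟F 1#
    ... | yes 0≡1 = ⊥-elim (0≢1 0≡1)
    ... | no  _   = refl
    normalised≡lead≟1 (a ∷ v) with a ≟F 0#
    ... | yes _ = normalised≡lead≟1 v
    ... | no  _ = refl

    normalised⇒lead≡1 : (v : Vec Carrier m) → T (normalised v) → lead v ≡ 1#
    normalised⇒lead≡1 v t = does-sound (lead v ≟F 1#) (subst T (normalised≡lead≟1 v) t)

    lead≡1⇒normalised : (v : Vec Carrier m) → lead v ≡ 1# → T (normalised v)
    lead≡1⇒normalised v e = subst T (sym (normalised≡lead≟1 v)) (does-complete (lead v ≟F 1#) e)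

    Point≢0ᵛ : (x : Point) → proj₁ x ≢ 0ᵛ
    Point≢0ᵛ (x , nx) x≡0 = 0≢1 (begin
      0#                   ≡⟨ lead-0ᵛ {suc n} ⟨
      lead (0ᵛ {suc n})    ≡⟨ cong lead x≡0 ⟨
      lead x               ≡⟨ normalised⇒lead≡1 x nx ⟩
      1#                   ∎)

    lead-·-normalised : ∀ c (u : Point) → lead (c · proj₁ u) ≡ c
    lead-·-normalised c (u , nu) = begin
      lead (c · u)  ≡⟨ lead-· c u ⟩
      c * lead u    ≡⟨ cong (c *_) (normalised⇒lead≡1 u nu) ⟩
      c * 1#        ≡⟨ ≈⇒≡ (*-identityʳ c) ⟩
      c             ∎

    distinct-points-independent : (x p : Point) → proj₁ x ≢ proj₁ p → ∀ c → proj₁ p ≢ c · proj₁ x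
    distinct-points-independent x p x≢p c p≡cx = x≢p (begin
      proj₁ x              ≡⟨ 1·v≡v (proj₁ x) ⟨
      1# · proj₁ x         ≡⟨ cong (_· proj₁ x) c≡1 ⟨
      c · proj₁ x          ≡⟨ p≡cx ⟨
      proj₁ p              ∎)
      where
      c≡1 : c ≡ 1#
      c≡1 = begin
        c                    ≡⟨ lead-·-normalised c x ⟨
        lead (c · proj₁ x)   ≡⟨ cong lead p≡cx ⟨
        lead (proj₁ p)       ≡⟨ normalised⇒lead≡1 (proj₁ p) (proj₂ p) ⟩
        1#                   ∎

    ScaleInvariant : (V → Bool) → Set
    ScaleInvariant P = ∀ c v → c ≢ 0# → P (c · v) ≡ P v

    isZero-dot-invariant : (x : V) → ScaleInvariant (λ h → isZero (dot h x))
    isZero-dot-invariant x c h c≢0 = trans (cong isZero (dot-·ˡ c h x)) (isZero-* c≢0 (dot h x))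

    module _ (P : V → Bool) where

      Solutions : (V → Bool) → Set
      Solutions Z = Σ (Subset V Z) (T ∘ P ∘ proj₁)

      zero-vector-size : T (P 0ᵛ) → HasSize (Solutions (isZero ∘ lead)) 1
      zero-vector-size P0ᵛ = HasSize-singleton (0ᵛ , does-complete (_ ≟F 0#) (lead-0ᵛ {suc n})) P0ᵛ
        (λ (v , lead≡0) _ → Subset-≡ (lead≡0⇒0ᵛ v (does-sound (_ ≟F 0#) lead≡0)))

      nonzero-vectors↔ : ScaleInvariant P → Solutions (not ∘ isZero ∘ lead) ↔ (Nonzero × Subset Point (P ∘ proj₁))
      nonzero-vectors↔ P-inv = mk↔ₛ′ to from to∘from from∘to
        where
        to : Solutions (not ∘ isZero ∘ lead) → Nonzero × Subset Point (P ∘ proj₁)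
        to ((v , v≠0) , Pv) = (lead v , v≠0)
          , ((a⁻¹ · v , lead≡1⇒normalised (a⁻¹ · v) lead≡1) , subst T (sym (P-inv a⁻¹ v a⁻¹≢0)) Pv)
          where
          a⁻¹ = proj₁ (inverse (lead v) (not-does-sound (_ ≟F 0#) v≠0))
          aa⁻¹≡1 = proj₂ (inverse (lead v) (not-does-sound (_ ≟F 0#) v≠0))
          a⁻¹≢0 = inverse-nonzero aa⁻¹≡1
          lead≡1 : lead (a⁻¹ · v) ≡ 1#
          lead≡1 = trans (lead-· a⁻¹ v) (trans (≈⇒≡ (*-comm a⁻¹ _)) aa⁻¹≡1)

        from : Nonzero × Subset Point (P ∘ proj₁) → Solutions (not ∘ isZero ∘ lead)
        from ((c , c≠0) , (u , Pu)) =
          (c · proj₁ u , not-does-complete (_ ≟F 0#) (c≢0 ∘ trans (sym (lead-·-normalised c u))))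
          , subst T (sym (P-inv c (proj₁ u) c≢0)) Pu
          where c≢0 = not-does-sound (_ ≟F 0#) c≠0

        to∘from : ∀ y → to (from y) ≡ y
        to∘from ((c , _) , (u , _)) =
          cong₂ _,_ (Subset-≡ (lead-·-normalised c u)) (Subset-≡ (Subset-≡ (rescale _)))
          where
          rescale : ∀ lead≢0 → proj₁ (inverse (lead (c · proj₁ u)) lead≢0) · c · proj₁ u ≡ proj₁ u
          rescale lead≢0 = ·-inverse b*c≡1 (proj₁ u)
            where
            b = proj₁ (inverse (lead (c · proj₁ u)) lead≢0)
            b*c≡1 : b * c ≡ 1#
            b*c≡1 = begin
              b * c                   ≡⟨ ≈⇒≡ (*-comm b c) ⟩
              c * b                   ≡⟨ cong (_* b) (lead-·-normalised c u) ⟨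
              lead (c · proj₁ u) * b  ≡⟨ proj₂ (inverse (lead (c · proj₁ u)) lead≢0) ⟩
              1#                      ∎

        from∘to : ∀ y → from (to y) ≡ y
        from∘to ((v , v≠0) , _) =
          Subset-≡ (Subset-≡ (·-inverse (proj₂ (inverse (lead v) (not-does-sound (_ ≟F 0#) v≠0))) v))

module Geometry {r : ℕ} (F : FiniteField (suc r)) ⦃ _ : NonZero r ⦄ where
  open import Data.Nat using (_+_; _*_; _^_)
  open import Data.Nat.Properties using (*-cancelˡ-≡; suc-injective)
  open FiniteField F using (Carrier)
  open QNumbers r using ([_]q; ^≡1+r*[k])
  open ≡-Reasoning
  open LinearAlgebra F
    using (isZero; lead; dot; dot-comm; isZero-dot-0ᵛ; 0ᵛ; Vec-size; Nonzero-size; kernel-size; kernel₂-size)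

  module _ (n : ℕ) where
    open PG F n using (Point; Hyperplane; inc; normalised)
    open LinearAlgebra.Projective F n

    projective-size : ∀ {X} (P : Vec Carrier (suc n) → Bool) → ScaleInvariant P → T (P 0ᵛ) →
                      HasSize (Subset Point (P ∘ proj₁)) X → HasSize (Subset (Vec Carrier (suc n)) P) (1 + r * X)
    projective-size P P-inv P0ᵛ e = HasSize-Σ-split (isZero ∘ lead) (zero-vector-size P P0ᵛ)
      (HasSize-↔ (HasSize-× Nonzero-size e) (↔-sym (nonzero-vectors↔ P P-inv)))

    projective-size⁻¹ : ∀ {k} (P : Vec Carrier (suc n) → Bool) → ScaleInvariant P → T (P 0ᵛ) →
                        HasSize (Subset (Vec Carrier (suc n)) P) (suc r ^ k) → HasSize (Subset Point (P ∘ proj₁)) [ k ]q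
    projective-size⁻¹ {k} P P-inv P0ᵛ e = subst (HasSize (Subset Point (P ∘ proj₁))) X≡[k] eX
      where
      Point-size = proj₂ (HasSize-subset (Vec-size (suc n)) normalised)
      X = proj₁ (HasSize-subset Point-size (P ∘ proj₁))
      eX = proj₂ (HasSize-subset Point-size (P ∘ proj₁))
      X≡[k] : X ≡ [ k ]q
      X≡[k] = *-cancelˡ-≡ X [ k ]q r (suc-injective (begin
        suc (r * X)       ≡⟨ HasSize-unique (projective-size P P-inv P0ᵛ eX) e ⟩
        suc r ^ k         ≡⟨ ^≡1+r*[k] k ⟩
        suc (r * [ k ]q)  ∎))

    points-size : HasSize Point [ suc n ]q
    points-size = HasSize-↔
      (projective-size⁻¹ {suc n} (λ _ → true) (λ _ _ _ → refl) _
                         (HasSize-↔ (Vec-size (suc n)) (↔-sym Subset-all)))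
      Subset-all

    hyperplanes-through : (x : Point) → HasSize (Subset Hyperplane (inc x)) [ n ]q
    hyperplanes-through (x , nx) = projective-size⁻¹ {n} (λ h → isZero (dot h x)) (isZero-dot-invariant x)
      (isZero-dot-0ᵛ x) (kernel-size x (Point≢0ᵛ (x , nx)))

    points-on : (A : Hyperplane) → HasSize (Subset Point (λ x → inc x A)) [ n ]q
    points-on A = HasSize-↔ (hyperplanes-through A)
      (Subset-cong-≡ (λ x → cong isZero (dot-comm (proj₁ x) (proj₁ A))))

  module _ (m : ℕ) where
    open PG F (suc m) using (Point; Hyperplane; inc)
    open LinearAlgebra.Projective F (suc m)

    hyperplanes-through-both : (x p : Point) → proj₁ x ≢ proj₁ p →
                               HasSize (Subset Hyperplane (λ H → inc x H ∧ inc p H)) [ m ]q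
    hyperplanes-through-both x p x≢p = projective-size⁻¹ (suc m) {m}
      (λ h → isZero (dot h (proj₁ x)) ∧ isZero (dot h (proj₁ p)))
      (λ c h c≢0 → cong₂ _∧_ (isZero-dot-invariant (proj₁ x) c h c≢0)
                              (isZero-dot-invariant (proj₁ p) c h c≢0))
      (Equivalence.from T-∧ (isZero-dot-0ᵛ (proj₁ x) , isZero-dot-0ᵛ (proj₁ p)))
      (kernel₂-size (proj₁ x) (proj₁ p) (Point≢0ᵛ x) (distinct-points-independent x p x≢p))

module QuasiSingular {r : ℕ} (F : FiniteField (suc r)) ⦃ _ : NonZero r ⦄ (m : ℕ) where
  open import Data.Nat using (_+_; _*_; _^_)
  open import Data.Sum.Algebra using (⊎-comm)
  open import Data.Vec.Properties using (≡-dec)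
  open FiniteField F using (_≟F_)
  open PG F (suc m)
  open Geometry F
  open QNumbers r using ([_]q; flag-count)

  eqP⇒≡ : (x y : Point) → T (eqP x y) → x ≡ y
  eqP⇒≡ x y t = Subset-≡ (does-sound (≡-dec _≟F_ (proj₁ x) (proj₁ y)) t)

  eqH⇒≡ : (H K : Hyperplane) → T (eqH H K) → H ≡ K
  eqH⇒≡ H K t = Subset-≡ (does-sound (≡-dec _≟F_ (proj₁ H) (proj₁ K)) t)

  eqP-refl : (x : Point) → T (eqP x x)
  eqP-refl x = does-complete (≡-dec _≟F_ (proj₁ x) (proj₁ x)) refl

  far-condition : ∀ a b c d → T (not (a ∨ b)) → (T d → T b) → a ∨ b ∨ c ∨ d ≡ c
  far-condition true  _     _ _     () _
  far-condition false true  _ _     () _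
  far-condition false false c false _  _   = ∨-identityʳ c
  far-condition false false _ true  _  d⇒b = ⊥-elim (d⇒b _)

  module _ (p : Point) (A : Hyperplane) where

    near : Point → Bool
    near x = eqP x p ∨ inc x A

    Fibre : Point → Set
    Fibre x = Subset Hyperplane (λ H → inc x H ∧ (eqP x p ∨ inc x A ∨ inc p H ∨ eqH H A))

    QS↔Σ-Fibre : QS p A ↔ Σ Point Fibre
    QS↔Σ-Fibre = mk↔ₛ′
      (λ (((x , H) , x∈H) , c) → x , H , Equivalence.from T-∧ (x∈H , c))
      (λ (x , H , t) → ((x , H) , proj₁ (Equivalence.to T-∧ t)) , proj₂ (Equivalence.to T-∧ t))
      (λ (x , _) → cong (x ,_) (Subset-≡ refl))
      (λ _ → Subset-≡ (Subset-≡ refl))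

    fibre-near : ∀ {x} → T (near x) → HasSize (Fibre x) [ suc m ]q
    fibre-near {x} t = HasSize-↔ (hyperplanes-through (suc m) x) (↔-sym (Subset-cong (T-∧-absorbʳ ∘ condition)))
      where
      condition : ∀ H → T (eqP x p ∨ inc x A ∨ inc p H ∨ eqH H A)
      condition H = subst T (∨-assoc (eqP x p) (inc x A) _) (Equivalence.from T-∨ (inj₁ t))

    fibre-far : ∀ {x} → T (not (near x)) → HasSize (Fibre x) [ m ]q
    fibre-far {x} t = HasSize-↔ (hyperplanes-through-both m x p x≢p)
      (Subset-cong-≡ (λ H → sym (∧-cong-T (inc x H) (λ x∈H →
        far-condition (eqP x p) (inc x A) (inc p H) (eqH H A) t
                      (λ H≡A → subst (T ∘ inc x) (eqH⇒≡ H A H≡A) x∈H)))))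
      where
      x≢p : proj₁ x ≢ proj₁ p
      x≢p = not-does-sound (≡-dec _≟F_ (proj₁ x) (proj₁ p)) (T-not-∨ˡ (eqP x p) t)

    near-singular : T (inc p A) → HasSize (Subset Point near) [ suc m ]q
    near-singular p∈A = HasSize-↔ (points-on (suc m) A)
      (Subset-cong (λ x → mk⇔ (λ x∈A → Equivalence.from T-∨ (inj₂ x∈A)) (near⇒∈A x)))
      where
      near⇒∈A : ∀ x → T (near x) → T (inc x A)
      near⇒∈A x t with Equivalence.to (T-∨ {eqP x p}) t
      ... | inj₁ x≡p = subst (λ y → T (inc y A)) (sym (eqP⇒≡ x p x≡p)) p∈A
      ... | inj₂ x∈A = x∈A

    near-nonsingular : ¬ T (inc p A) → HasSize (Subset Point near) ([ suc m ]q + 1)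
    near-nonsingular p∉A = HasSize-↔
      (HasSize-⊎ (points-on (suc m) A) (HasSize-singleton p (eqP-refl p) (λ x → eqP⇒≡ x p)))
      (↔-trans (⊎-comm _ _) (↔-sym (Subset-∨ x∈A⇒x≢p)))
      where
      x∈A⇒x≢p : ∀ x → T (inc x A) → T (not (eqP x p))
      x∈A⇒x≢p x x∈A = not-does-complete (≡-dec _≟F_ (proj₁ x) (proj₁ p))
        (λ x≡p → p∉A (subst (λ y → T (inc y A)) (Subset-≡ {s = proj₂ x} {t = proj₂ p} x≡p) x∈A))

    QS-size : ∀ {c₁} → HasSize (Subset Point near) c₁ →
              HasSize (QS p A) (Formulas.common (suc r) (suc m) + c₁ * suc r ^ m)
    QS-size {c₁} e₁ = subst (HasSize (QS p A)) (flag-count m c₁ c₂ c₁+c₂≡N)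
      (HasSize-↔ (HasSize-Σ-split near (HasSize-Σ-const e₁ (λ (x , t) → fibre-near {x} t))
                                       (HasSize-Σ-const e₂ (λ (x , t) → fibre-far {x} t)))
                 (↔-sym QS↔Σ-Fibre))
      where
      c₂ = proj₁ (HasSize-subset (points-size (suc m)) (not ∘ near))
      e₂ = proj₂ (HasSize-subset (points-size (suc m)) (not ∘ near))
      c₁+c₂≡N = HasSize-unique (HasSize-partition near e₁ e₂) (points-size (suc m))

proposition2p10 : ∀ {q : ℕ} (F : FiniteField q) {{_ : NonZero (q ∸ 1)}} (n : ℕ) → 2 ≤ n →
    (∀ (p : PG.Point F n) (A : PG.Hyperplane F n) → PG._∈H_ F n p A →
       HasSize (PG.QS F n p A) (Formulas.singularSize q n))
    × (∀ (p : PG.Point F n) (A : PG.Hyperplane F n) → ¬ (PG._∈H_ F n p A) →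
       HasSize (PG.QS F n p A) (Formulas.nonSingularSize q n))
proposition2p10 {zero}  F ⦃ () ⦄ n       _
proposition2p10 {suc r} F        (suc m) (s≤s _) =
  (λ p A p∈A → QS-size p A (near-singular p A p∈A)) ,
  (λ p A p∉A → QS-size p A (near-nonsingular p A p∉A))
  where open QuasiSingular F m
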